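{- For every run of the roundabout exploration process and every $t\in[N]$, no two distinct agents in $A(t)$ have the same state after step $t$.
   Context: Let $n\ge2$ and $k\ge1$ be integers, and let $T$ be a tree on a vertex set $V$ with $|V|=n$, rooted at $r$. DFS tour. Fix a depth-first-search tour of $T$ that starts and ends at $r$ and traverses each edge of $T$ exactly twice. Write it as $(v_1,\dots,v_N,v_{N+1})$ with $v_1=v_{N+1}=r$ and $N=2(n-1)$, and put $e_i=\{v_i,v_{i+1}\}$ for $i\in[N]$. Circular intervals. For $i,j\in[N]$, let $[i,j]=\{i,\dots,j\}$ if $i\le j$, and $[i,j]=\{i,\dots,N,1,\dots,j\}$ if $i>j$. Snapshots. Let $G_1,\dots,G_N$ be graphs on $V$, each containing all but at most $k$ edges of $T$. Roundabout exploration process. There are agents $a_1,\dots,a_N$ with initial states $s_i(0)=i$. Set $D_i(0)=\{i\}$ and $A(0)=\{a_1,\dots,a_N\}$. For $t=1,\dots,N$ do: (1) Movement: if $s_i(t-1)=q$, then $s_i(t)=(q\bmod N)+1$ if $e_q\in E(G_t)$, and $s_i(t)=q$ otherwise. (2) Elimination: let $D_i(t)=[i,s_i(t)]$. Starting from $A(t-1)$, repeatedly remove an arbitrary agent $a_i$ of the current set with $D_i(t)\subseteq\bigcup_{a_j\text{ in current set},\,j\neq i}D_j(t)$, until no such agent remains. The result is $A(t)$. The state of $a_i$ after step $t$ is $s_i(t)$. A run is any execution of this process, i.e. any choice of removed agents. -}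

module Defs where

open import Data.Nat as ℕ using (ℕ; zero; suc; _+_; _*_; _∸_; _≤_; _<_)
open import Data.Nat.Properties using (<⇒≤)
open import Data.Bool using (Bool; true; false; if_then_else_; _∧_; _∨_; not)
open import Data.Fin as Fin using (Fin; toℕ; fromℕ; fromℕ<; inject₁)
open import Data.Fin.Subset using (Subset; _∈_; outside; ⊤)
open import Data.Vec using (_[_]≔_)
open import Data.List using (List; map)
open import Data.Nat.ListAction using (sum)
open import Data.List.Base using () renaming (allFin to allFinL)
open import Data.Product using (Σ; ∃; _×_; _,_)
open import Data.Sum using (_⊎_)
open import Relation.Nullary using (¬_; yes; no; does)
open import Relation.Binary.PropositionalEquality using (_≡_; _≢_)
open import Function.Definitions using (Injective)

record Graph (n : ℕ) : Set where
  field
    adj    : Fin n → Fin n → Bool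
    adj-sym : ∀ u v → adj u v ≡ adj v u
    adj-irr : ∀ u → adj u u ≡ false
open Graph public

_∈E_ : ∀ {n} → Fin n × Fin n → Graph n → Set
(u , v) ∈E G = adj G u v ≡ true

cyc : ∀ {N} → Fin N → Fin N
cyc {suc M} q with suc (toℕ q) ℕ.<? suc M
... | yes p = fromℕ< p
... | no  _ = Fin.zero

data Walk {n} (G : Graph n) : Fin n → Fin n → Set where
  [] : ∀ {u} → Walk G u u
  _∷_ : ∀ {u v w} → (u , v) ∈E G → Walk G v w → Walk G u w

Connected : ∀ {n} → Graph n → Set
Connected G = ∀ u w → Walk G u w

HasCycle : ∀ {n} → Graph n → Set
HasCycle {n} G = Σ ℕ λ L → 3 ≤ L × Σ (Fin L → Fin n) λ c →
  Injective _≡_ _≡_ c × (∀ i → (c i , c (cyc i)) ∈E G)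

IsTree : ∀ {n} → Graph n → Set
IsTree G = Connected G × ¬ HasCycle G

countFin : ∀ {m} → (Fin m → Bool) → ℕ
countFin {m} p = sum (map (λ i → if p i then 1 else 0) (allFinL m))

sameEdge : ∀ {n} → Fin n → Fin n → Fin n → Fin n → Bool
sameEdge x y u w =
  (does (x Fin.≟ u) ∧ does (y Fin.≟ w)) ∨ (does (x Fin.≟ w) ∧ does (y Fin.≟ u))

sumFin : ∀ {m} → (Fin m → ℕ) → ℕ
sumFin {m} f = sum (map f (allFinL m))

missingEdges : ∀ {n} → Graph n → Graph n → ℕ
missingEdges T G = sumFin λ u → countFin λ w →
  does (toℕ u ℕ.<? toℕ w) ∧ adj T u w ∧ not (adj G u w)

-- Closed walk (v₀,…,v_N) in T from r to r traversing every edge of T exactly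
-- twice (0-based: paper's v_{i+1} is our v i; e_i = {v i , v (i+1)}).

record IsTour {n N} (T : Graph n) (r : Fin n) (v : Fin (suc N) → Fin n) : Set where
  field
    start : v Fin.zero ≡ r
    end   : v (fromℕ N) ≡ r
    steps : ∀ (i : Fin N) → (v (inject₁ i) , v (Fin.suc i)) ∈E T
    twice : ∀ u w → (u , w) ∈E T →
            countFin (λ (i : Fin N) → sameEdge (v (inject₁ i)) (v (Fin.suc i)) u w) ≡ 2

-- Parameters: the tour v and the snapshots
-- G : Fin N → Graph n  (our G t is the paper's G_{t+1}).  Agents and positions
-- are Fin N (our agent i is the paper's a_{i+1}, our position q is paper's q+1).

module Roundabout {n N : ℕ} (v : Fin (suc N) → Fin n) (G : Fin N → Graph n) where

  move : Fin N → Fin N → Fin N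
  move t q = if adj (G t) (v (inject₁ q)) (v (Fin.suc q)) then cyc q else q

  state : Fin N → (t : ℕ) → .(t ≤ N) → Fin N
  state i zero    _ = i
  state i (suc t) p = move (fromℕ< p) (state i t (<⇒≤ p))

  InInterval : Fin N → Fin N → Fin N → Set
  InInterval i j x with toℕ i ℕ.≤? toℕ j
  ... | yes _ = toℕ i ≤ toℕ x × toℕ x ≤ toℕ j
  ... | no  _ = toℕ i ≤ toℕ x ⊎ toℕ x ≤ toℕ j

  D : Fin N → (t : ℕ) → .(t ≤ N) → Fin N → Set
  D i t p x = InInterval i (state i t p) x

  Covered : (t : ℕ) → .(t ≤ N) → Subset N → Fin N → Set
  Covered t p S i = ∀ x → D i t p x → ∃ λ j → j ∈ S × j ≢ i × D j t p x

  -- Elim t S S' : S' is a possible result of the elimination phase at time t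
  -- started from S (repeatedly remove an arbitrary removable agent until none is).
  data Elim (t : ℕ) .(p : t ≤ N) : Subset N → Subset N → Set where
    stop   : ∀ {S} → ¬ (∃ λ i → i ∈ S × Covered t p S i) → Elim t p S S
    remove : ∀ {S S'} i → i ∈ S → Covered t p S i →
             Elim t p (S [ i ]≔ outside) S' → Elim t p S S'

  -- A run: a choice of sets A(0),…,A(N) (values at t > N are irrelevant)
  -- with A(0) = all agents and each A(t+1) produced from A(t) by elimination.
  record Run : Set where
    field
      A     : ℕ → Subset N
      A-0   : A 0 ≡ ⊤
      A-suc : ∀ t (p : suc t ≤ N) → Elim (suc t) p (A t) (A (suc t))

{-# OPTIONS --safe #-}
-- Circular intervals [i, s] and [j, s] with a common right end are nested, so
-- if two agents of A(t) had the same state, the one with the smaller interval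
-- would be covered by the other; but elimination only stops once no agent of
-- the current set is covered. Neither the tree, the tour nor the snapshots
-- play any role.
module Submission where

open import Defs
open import Data.Nat using (ℕ; suc; _*_; _∸_; _≤_; _≤?_)
open import Data.Nat.Properties using (≤-trans; ≤-total)
open import Data.Fin using (Fin; toℕ)
open import Data.Fin.Subset using (_∈_)
open import Data.Product using (_,_)
open import Data.Sum using (_⊎_; inj₁; inj₂)
open import Function using (_∘_)
open import Relation.Nullary using (¬_; yes; no)
open import Relation.Unary using (_⊆_)
open import Relation.Binary.PropositionalEquality using (_≡_; _≢_; refl; sym; subst)

module _ {n N : ℕ} (v : Fin (suc N) → Fin n) (G : Fin N → Graph n) where
  open Roundabout v G

  Elim-uncovered : ∀ {t} .{p : t ≤ N} {S S'} → Elim t p S S' →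
                   ∀ {i} → i ∈ S' → ¬ Covered t p S' i
  Elim-uncovered (stop none)        i∈S' cov = none (_ , i∈S' , cov)
  Elim-uncovered (remove _ _ _ rest) = Elim-uncovered rest

  InInterval-nested : ∀ i j s →
                      InInterval i s ⊆ InInterval j s ⊎ InInterval j s ⊆ InInterval i s
  InInterval-nested i j s with toℕ i ≤? toℕ s | toℕ j ≤? toℕ s | ≤-total (toℕ i) (toℕ j)
  ... | yes _ | yes _ | inj₁ i≤j = inj₂ λ (j≤x , x≤s) → ≤-trans i≤j j≤x , x≤s
  ... | yes _ | yes _ | inj₂ j≤i = inj₁ λ (i≤x , x≤s) → ≤-trans j≤i i≤x , x≤s
  ... | yes _ | no _  | _        = inj₁ λ (_ , x≤s) → inj₂ x≤s
  ... | no _  | yes _ | _        = inj₂ λ (_ , x≤s) → inj₂ x≤s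
  ... | no _  | no _  | inj₁ i≤j = inj₂ λ { (inj₁ j≤x) → inj₁ (≤-trans i≤j j≤x) ; (inj₂ x≤s) → inj₂ x≤s }
  ... | no _  | no _  | inj₂ j≤i = inj₁ λ { (inj₁ i≤x) → inj₁ (≤-trans j≤i i≤x) ; (inj₂ x≤s) → inj₂ x≤s }

  covered-by-same-state : ∀ {t} .{p : t ≤ N} {S i j s} → j ∈ S → j ≢ i →
                          state i t p ≡ s → state j t p ≡ s →
                          InInterval i s ⊆ InInterval j s → Covered t p S i
  covered-by-same-state {j = j} j∈S j≢i sᵢ≡s sⱼ≡s i⊆j x x∈Dᵢ =
    j , j∈S , j≢i , subst (λ s → InInterval j s x) (sym sⱼ≡s)
                      (i⊆j (subst (λ s → InInterval _ s x) sᵢ≡s x∈Dᵢ))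

  Elim-distinct-states : ∀ {t} .{p : t ≤ N} {S S'} → Elim t p S S' →
                         ∀ {i j} → i ∈ S' → j ∈ S' → i ≢ j → state i t p ≢ state j t p
  Elim-distinct-states {t} {p} e {i} {j} i∈S' j∈S' i≢j sᵢ≡sⱼ
    with InInterval-nested i j (state i t p)
  ... | inj₁ i⊆j = Elim-uncovered e i∈S'
                     (covered-by-same-state {t} j∈S' (i≢j ∘ sym) refl (sym sᵢ≡sⱼ) i⊆j)
  ... | inj₂ j⊆i = Elim-uncovered e j∈S'
                     (covered-by-same-state {t} i∈S' i≢j (sym sᵢ≡sⱼ) refl j⊆i)

lemma5 : (n k : ℕ) → 2 ≤ n → 1 ≤ k →
         (T : Graph n) → IsTree T → (r : Fin n) →
         (v : Fin (suc (2 * (n ∸ 1))) → Fin n) → IsTour T r v →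
         (G : Fin (2 * (n ∸ 1)) → Graph n) →
         (∀ t → missingEdges T (G t) ≤ k) →
         (run : Roundabout.Run v G) →
         ∀ t → (p : t ≤ 2 * (n ∸ 1)) → 1 ≤ t →
         ∀ i j → i ∈ Roundabout.Run.A run t → j ∈ Roundabout.Run.A run t → i ≢ j →
         Roundabout.state v G i t p ≢ Roundabout.state v G j t p
lemma5 n k _ _ T _ r v _ G _ run (suc t) p _ i j =
  Elim-distinct-states v G (Roundabout.Run.A-suc run t p)
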